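{- Let $(P,\varphi)$, $(P',\varphi')$, $(P'',\varphi'')$ be closure systems. Let $f:(P,\varphi)\to(P',\varphi')$ and $g:(P',\varphi')\to(P'',\varphi'')$ be transformations, with $g$ monotone and continuous. If both $f$ and $g$ are surjective, then the composite $f.g:(P,\varphi)\to(P'',\varphi'')$ (first $f$, then $g$) is surjective.
   Context: Suffix notation is used: $Y.f.g$ means apply $f$, then $g$. A closure operator is extensive, monotone and idempotent on subsets, and $Y$ is closed if $Y.\varphi=Y$. A transformation maps subsets of the domain ground set to subsets of the codomain ground set. It is monotone if $X\subseteq Y\Rightarrow X.f\subseteq Y.f$. It is continuous if $Y.\varphi.f\subseteq Y.f.\varphi'$ for all $Y$. A transformation $f:(P,\varphi)\to(P',\varphi')$ is surjective if for every closed $Y'\subseteq P'$ there is some $Y\subseteq P$ (not necessarily closed) with $Y.f=Y'$. -}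

module Defs where

open import Level using (Level; _⊔_) renaming (suc to lsuc)
open import Data.Product using (∃)
open import Relation.Unary using (Pred; _⊆_; _≐_)

record ClosureOperator {a : Level} (ℓ : Level) (P : Set a) : Set (a ⊔ lsuc ℓ) where
  field
    cl         : Pred P ℓ → Pred P ℓ
    extensive  : ∀ (Y : Pred P ℓ) → Y ⊆ cl Y
    monotone   : ∀ {X Y : Pred P ℓ} → X ⊆ Y → cl X ⊆ cl Y
    idempotent : ∀ (Y : Pred P ℓ) → cl (cl Y) ≐ cl Y

open ClosureOperator public

record ClosureSystem (a ℓ : Level) : Set (lsuc (a ⊔ ℓ)) where
  field
    Carrier : Set a
    φ       : ClosureOperator ℓ Carrier

open ClosureSystem public

Subset : ∀ {a ℓ} → ClosureSystem a ℓ → Set (a ⊔ lsuc ℓ)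
Subset {ℓ = ℓ} S = Pred (Carrier S) ℓ

Closed : ∀ {a ℓ} (S : ClosureSystem a ℓ) → Subset S → Set (a ⊔ ℓ)
Closed S Y = cl (φ S) Y ≐ Y

Transformation : ∀ {a ℓ} → ClosureSystem a ℓ → ClosureSystem a ℓ → Set (a ⊔ lsuc ℓ)
Transformation S S' = Subset S → Subset S'

-- Composite in suffix notation: Y.(f.g) = (Y.f).g
_⨾_ : ∀ {a ℓ} {S S' S'' : ClosureSystem a ℓ} →
      Transformation S S' → Transformation S' S'' → Transformation S S''
(f ⨾ g) Y = g (f Y)

Monotone : ∀ {a ℓ} {S S' : ClosureSystem a ℓ} → Transformation S S' → Set (a ⊔ lsuc ℓ)
Monotone {S = S} f = ∀ {X Y : Subset S} → X ⊆ Y → f X ⊆ f Y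

Continuous : ∀ {a ℓ} (S S' : ClosureSystem a ℓ) → Transformation S S' → Set (a ⊔ lsuc ℓ)
Continuous S S' f = ∀ (Y : Subset S) → f (cl (φ S) Y) ⊆ cl (φ S') (f Y)

Surjective : ∀ {a ℓ} (S S' : ClosureSystem a ℓ) → Transformation S S' → Set (a ⊔ lsuc ℓ)
Surjective S S' f = ∀ (Y' : Subset S') → Closed S' Y' → ∃ λ (Y : Subset S) → f Y ≐ Y'

module Submission where

-- Let Y'' ⊆ P'' be closed.  Surjectivity of g gives Y' with Y'.g = Y''.  The
-- set Y' need not be closed, so f cannot be applied to it directly; instead we
-- use its closure Y'.φ', which is closed, and surjectivity of f gives Y with
-- Y.f = Y'.φ'.  It remains to see that closing the argument does not change
-- the image: for monotone continuous g whose image Y'.g is closed,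
--   Y'.g ⊆ Y'.φ'.g ⊆ Y'.g.φ'' = Y'.g
-- (extensivity and monotonicity, then continuity, then closedness).

open import Level using (Level)
open import Data.Product using (_,_; proj₁; proj₂)
open import Relation.Unary using (_≐_)
open import Relation.Unary.Properties using (≐-trans)
open import Defs

closure-closed : ∀ {a ℓ} (S : ClosureSystem a ℓ) (Y : Subset S) →
                 Closed S (cl (φ S) Y)
closure-closed S Y = idempotent (φ S) Y

closed-resp-≐ : ∀ {a ℓ} (S : ClosureSystem a ℓ) {X Y : Subset S} →
                X ≐ Y → Closed S Y → Closed S X
closed-resp-≐ S {X} X≐Y (clY⊆Y , _) =
    (λ x∈clX → proj₂ X≐Y (clY⊆Y (monotone (φ S) (proj₁ X≐Y) x∈clX)))
  , extensive (φ S) X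

monotone-resp-≐ : ∀ {a ℓ} {S S' : ClosureSystem a ℓ} (g : Transformation S S') →
                  Monotone {S = S} {S' = S'} g →
                  ∀ {X Y : Subset S} → X ≐ Y → g X ≐ g Y
monotone-resp-≐ g mon (X⊆Y , Y⊆X) = mon X⊆Y , mon Y⊆X

closing-preserves-closed-image :
  ∀ {a ℓ} (S S' : ClosureSystem a ℓ) (g : Transformation S S') →
  Monotone {S = S} {S' = S'} g → Continuous S S' g →
  ∀ (Y : Subset S) → Closed S' (g Y) → g (cl (φ S) Y) ≐ g Y
closing-preserves-closed-image S S' g mon cont Y (clgY⊆gY , _) =
    (λ x∈gclY → clgY⊆gY (cont Y x∈gclY))
  , mon (extensive (φ S) Y)

proposition5 : ∀ {a ℓ : Level} (S S' S'' : ClosureSystem a ℓ)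
    (f : Transformation S S') (g : Transformation S' S'') →
    Monotone {S = S'} {S' = S''} g → Continuous S' S'' g →
    Surjective S S' f → Surjective S' S'' g →
    Surjective S S'' (_⨾_ {S = S} {S' = S'} {S'' = S''} f g)
proposition5 S S' S'' f g mon cont surj-f surj-g Y'' Y''-closed
  with surj-g Y'' Y''-closed
... | Y' , gY'≐Y''
  with surj-f (cl (φ S') Y') (closure-closed S' Y')
... | Y , fY≐clY' = Y , gfY≐Y''
  where
    gfY≐Y'' : g (f Y) ≐ Y''
    gfY≐Y'' = ≐-trans (monotone-resp-≐ {S = S'} {S' = S''} g mon fY≐clY')
                (≐-trans (closing-preserves-closed-image S' S'' g mon cont Y'
                            (closed-resp-≐ S'' gY'≐Y'' Y''-closed))
                         gY'≐Y'')
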